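{- For every non-negative integer $n$: (1) $|\mathcal{SOR}_{1,n}|=n+1$; (2) $|\mathcal{SOR}_{2,n}|=n^4-2n^3+5n^2+1$; (3) $|\mathcal{SOR}_{3,n}|=n^9-15n^8+122n^7-604n^6+1973n^5-4201n^4+5640n^3-4240n^2+1347n+1$.
   Context: An $r\times r$ partial Latin rectangle based on $[n]=\{1,\ldots,n\}$ ($[0]=\emptyset$) is an $r\times r$ array in which each cell is either empty or contains a symbol of $[n]$, each symbol occurring at most once in each row and in each column. Two such arrays $P=(p_{ij}),Q=(q_{ij})$ are orthogonal if whenever $p_{ij}=p_{i'j'}\in[n]$ for distinct cells $(i,j)\neq(i',j')$, the entries $q_{ij}$ and $q_{i'j'}$ are not the same symbol of $[n]$. $P$ is self-orthogonal if it is orthogonal to its transpose. $\mathcal{SOR}_{r,n}$ denotes the set of self-orthogonal $r\times r$ partial Latin rectangles based on $[n]$. -}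

module Defs where

open import Data.Nat using (ℕ)
open import Data.Fin using (Fin)
open import Data.Maybe using (Maybe; just)
open import Data.Vec using (Vec; lookup; transpose)
open import Data.List using (List; length)
open import Data.List.Membership.Propositional using (_∈_)
open import Data.List.Relation.Unary.Unique.Propositional using (Unique)
open import Data.Product using (Σ; _×_; _,_)
open import Data.Empty using (⊥)
open import Data.Integer using (ℤ; +_)
open import Relation.Nullary using (¬_)
open import Relation.Binary.PropositionalEquality using (_≡_)

Array : ℕ → ℕ → Set
Array r n = Vec (Vec (Maybe (Fin n)) r) r

entry : ∀ {r n} → Array r n → Fin r → Fin r → Maybe (Fin n)
entry A i j = lookup (lookup A i) j

IsPartialLatin : ∀ {r n} → Array r n → Set
IsPartialLatin {r} {n} A =
  (∀ (i j j' : Fin r) (s : Fin n) → entry A i j ≡ just s → entry A i j' ≡ just s → j ≡ j')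
  × (∀ (i i' j : Fin r) (s : Fin n) → entry A i j ≡ just s → entry A i' j ≡ just s → i ≡ i')

Orthogonal : ∀ {r n} → Array r n → Array r n → Set
Orthogonal {r} {n} P Q =
  ∀ (i j i' j' : Fin r) (s t : Fin n) →
    ¬ ((i , j) ≡ (i' , j')) →
    entry P i j ≡ just s → entry P i' j' ≡ just s →
    entry Q i j ≡ just t → entry Q i' j' ≡ just t → ⊥

IsSOR : (r n : ℕ) → Array r n → Set
IsSOR r n A = IsPartialLatin A × Orthogonal A (transpose A)

HasCard : {A : Set} → (A → Set) → ℤ → Set
HasCard {A} P k =
  Σ (List A) λ L → Unique L × (∀ x → (P x → x ∈ L) × (x ∈ L → P x)) × (+ length L ≡ k)

module Submission where

-- Whether an array belongs to SOR_{r,n} depends only on its shape: which cells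
-- are empty and which pairs of cells hold the same symbol.  Every array arises
-- in exactly one way from a canonical pattern, a labelling of the cells by
-- classes 0, 1, ..., k-1 numbered by first occurrence, by choosing k distinct
-- symbols of [n] for the classes, i.e. an injection [k] → [n]; there are
-- n (n-1) ⋯ (n-k+1) of these.  Hence |SOR_{r,n}| = Σ_p (n)_{k(p)}, a polynomial
-- in n, where p ranges over the canonical patterns of the r·r cells whose
-- shape satisfies the SOR conditions.
--
-- For r = 1, 2, 3 the coefficients of
-- the counting polynomial are computed by evaluation and matched with the
-- closed forms of the theorem by the ring solver.

open import Defs
open import Data.Bool using (Bool; true; false; _∧_; _∨_; not; if_then_else_; T)
open import Data.Empty using (⊥-elim)
open import Data.Unit using (⊤; tt)
open import Data.Fin using (Fin; zero; suc)
import Data.Fin as Fin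
import Data.Fin.Properties as FinP
open import Data.Integer using (ℤ; +_; _+_; _-_; _*_; -_; _^_)
import Data.Integer.Properties as ℤP
import Data.Bool.Properties as BoolP
open import Data.Integer.Tactic.RingSolver using (solve-∀)
open import Data.Integer.Solver using (module +-*-Solver)
open +-*-Solver using (Polynomial; solve; _:=_; con; _:+_; _:-_; _:*_; _:^_)
open import Data.List using (List; []; _∷_; [_]; _++_; length; map; concatMap; filter; foldr; allFin; upTo)
import Data.List.Properties as ListP
open import Data.List.Membership.Propositional using (_∈_; _∉_; find; lose)
import Data.List.Membership.Propositional.Properties as ∈P
open import Data.List.Relation.Unary.All as All using (All; []; _∷_)
open import Data.List.Relation.Unary.Any using (here; there)
open import Data.List.Relation.Unary.AllPairs using ([]; _∷_)
open import Data.List.Relation.Unary.Unique.Propositional using (Unique)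
import Data.List.Relation.Unary.Unique.Propositional.Properties as UniqueP
open import Data.Maybe using (Maybe; just; nothing)
import Data.Maybe as Maybe
open import Data.Nat using (ℕ; zero; suc; _≤_; _<_; _∸_; z≤n; s≤s)
import Data.Nat as ℕ
import Data.Nat.Properties as ℕP
open import Data.Product using (∃; _×_; _,_; proj₁; proj₂)
import Data.Product as Product
import Data.Product.Properties as ProductP
open import Data.Sum using (_⊎_; inj₁; inj₂)
open import Data.Vec using (Vec; lookup) renaming ([] to []ᵥ; _∷_ to _∷ᵥ_)
import Data.Vec as Vec
import Data.Vec.Properties as VecP
open import Function using (_∘_; Equivalence)
open import Relation.Binary.Definitions using (DecidableEquality)
open import Relation.Nullary using (¬_; does; yes; no; ¬?; contradiction)
open import Relation.Nullary.Decidable using (dec-true; dec-false; T?)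
open import Relation.Binary.PropositionalEquality using (_≡_; _≢_; refl; sym; trans; cong; cong₂; subst; subst₂; module ≡-Reasoning)

private variable
  A B : Set

∈-concatMap⁺′ : (f : A → List B) {xs : List A} {x : A} {y : B} →
  x ∈ xs → y ∈ f x → y ∈ concatMap f xs
∈-concatMap⁺′ f x∈xs y∈fx = ∈P.∈-concatMap⁺ f (lose x∈xs y∈fx)

∈-concatMap⁻′ : (f : A → List B) (xs : List A) {y : B} →
  y ∈ concatMap f xs → ∃ λ x → x ∈ xs × y ∈ f x
∈-concatMap⁻′ f xs y∈ = find (∈P.∈-concatMap⁻ f {xs = xs} y∈)

concatMap-unique : (f : A → List B) (tag : B → A) {xs : List A} → Unique xs →
  (∀ x → x ∈ xs → Unique (f x)) → (∀ x y → x ∈ xs → y ∈ f x → tag y ≡ x) →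
  Unique (concatMap f xs)
concatMap-unique f tag {[]} [] uf tagged = []
concatMap-unique f tag {x ∷ xs} (x∉xs ∷ u) uf tagged =
  UniqueP.++⁺ (uf x (here refl))
    (concatMap-unique f tag u (λ y m → uf y (there m)) (λ y z m → tagged y z (there m)))
    disjoint
  where
  disjoint : ∀ {v} → ¬ (v ∈ f x × v ∈ concatMap f xs)
  disjoint (v∈fx , v∈rest) with ∈-concatMap⁻′ f xs v∈rest
  ... | x' , x'∈xs , v∈fx' =
    All.lookup x∉xs x'∈xs (trans (sym (tagged x _ (here refl) v∈fx)) (tagged x' _ (there x'∈xs) v∈fx'))

length-concatMap-const : (f : A → List B) (xs : List A) (c : ℕ) →
  (∀ x → x ∈ xs → length (f x) ≡ c) → length (concatMap f xs) ≡ length xs ℕ.* c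
length-concatMap-const f [] c h = refl
length-concatMap-const f (x ∷ xs) c h = trans (ListP.length-++ (f x))
  (cong₂ ℕ._+_ (h x (here refl)) (length-concatMap-const f xs c (λ y m → h y (there m))))

map-unique-retract : (f : A → B) (g : B → A) {xs : List A} →
  (∀ x → x ∈ xs → g (f x) ≡ x) → Unique xs → Unique (map f xs)
map-unique-retract f g {xs} retract u = UniqueP.map⁻ (subst Unique (sym gfxs≡xs) u)
  where
  gfxs≡xs : map g (map f xs) ≡ xs
  gfxs≡xs = trans (sym (ListP.map-∘ xs)) (ListP.map-id-local (All.tabulate (retract _)))

length-remove : (_≟_ : DecidableEquality A) {x : A} {zs : List A} →
  Unique zs → x ∈ zs → suc (length (filter (λ y → ¬? (y ≟ x)) zs)) ≡ length zs
length-remove _≟_ {x} (x∉zs ∷ u) (here refl) = cong (suc ∘ length)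
  (trans (ListP.filter-reject (λ y → ¬? (y ≟ x)) (λ x≢x → x≢x refl))
         (ListP.filter-all (λ y → ¬? (y ≟ x)) (All.map (λ x≢y y≡x → x≢y (sym y≡x)) x∉zs)))
length-remove _≟_ {x} (z∉zs ∷ u) (there x∈zs) = cong suc (trans
  (cong length (ListP.filter-accept (λ y → ¬? (y ≟ x)) (All.lookup z∉zs x∈zs)))
  (length-remove _≟_ u x∈zs))

_!?_ : List A → ℕ → Maybe A
[] !? _ = nothing
(x ∷ xs) !? zero = just x
(x ∷ xs) !? suc i = xs !? i

!?-++ˡ : (xs ys : List A) {i : ℕ} → i < length xs → (xs ++ ys) !? i ≡ xs !? i
!?-++ˡ (x ∷ xs) ys {zero} _ = refl
!?-++ˡ (x ∷ xs) ys {suc i} (s≤s i<) = !?-++ˡ xs ys i<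

!?-length : (xs ys : List A) (x : A) → (xs ++ x ∷ ys) !? length xs ≡ just x
!?-length [] ys x = refl
!?-length (_ ∷ xs) ys x = !?-length xs ys x

!?-bound : (xs : List A) (i : ℕ) {x : A} → xs !? i ≡ just x → i < length xs
!?-bound (_ ∷ xs) zero _ = s≤s z≤n
!?-bound (_ ∷ xs) (suc i) eq = s≤s (!?-bound xs i eq)

!?-∈ : (xs : List A) (i : ℕ) {x : A} → xs !? i ≡ just x → x ∈ xs
!?-∈ (_ ∷ xs) zero refl = here refl
!?-∈ (_ ∷ xs) (suc i) eq = there (!?-∈ xs i eq)

!?-defined : (xs : List A) {i : ℕ} → i < length xs → ∃ λ x → xs !? i ≡ just x
!?-defined (x ∷ xs) {zero} _ = x , refl
!?-defined (x ∷ xs) {suc i} (s≤s i<) = !?-defined xs i<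

!?-injective : (xs : List A) → Unique xs → ∀ i j {x} → xs !? i ≡ just x → xs !? j ≡ just x → i ≡ j
!?-injective (y ∷ xs) u zero zero _ _ = refl
!?-injective (y ∷ xs) (y∉ ∷ u) zero (suc j) refl eq = contradiction refl (All.lookup y∉ (!?-∈ xs j eq))
!?-injective (y ∷ xs) (y∉ ∷ u) (suc i) zero eq refl = contradiction refl (All.lookup y∉ (!?-∈ xs i eq))
!?-injective (y ∷ xs) (_ ∷ u) (suc i) (suc j) eq eq' = cong suc (!?-injective xs u i j eq eq')

length-snoc : (xs : List A) (x : A) → length (xs ++ [ x ]) ≡ suc (length xs)
length-snoc xs x = trans (ListP.length-++ xs) (ℕP.+-comm (length xs) 1)

unique-++ˡ : (xs ys : List A) → Unique (xs ++ ys) → Unique xs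
unique-++ˡ [] ys u = []
unique-++ˡ (x ∷ xs) ys (x∉ ∷ u) = All.tabulate (λ y∈ → All.lookup x∉ (∈P.∈-++⁺ˡ y∈)) ∷ unique-++ˡ xs ys u

unique-middle : (xs ys : List A) (y : A) → Unique (xs ++ y ∷ ys) → y ∉ xs
unique-middle (x ∷ xs) ys y (x∉ ∷ u) (here refl) = All.lookup x∉ (∈P.∈-++⁺ʳ xs (here refl)) refl
unique-middle (x ∷ xs) ys y (_ ∷ u) (there y∈) = unique-middle xs ys y u y∈

-- Integer polynomials as coefficient lists (constant term first), with
-- Horner evaluation ⟦ p ⟧ x.
Poly : Set
Poly = List ℤ

⟦_⟧ : Poly → ℤ → ℤ
⟦ [] ⟧ x = + 0
⟦ a ∷ p ⟧ x = a + x * ⟦ p ⟧ x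

_⊕_ : Poly → Poly → Poly
[] ⊕ q = q
(a ∷ p) ⊕ [] = a ∷ p
(a ∷ p) ⊕ (b ∷ q) = (a + b) ∷ (p ⊕ q)

⟦⊕⟧ : ∀ p q x → ⟦ p ⊕ q ⟧ x ≡ ⟦ p ⟧ x + ⟦ q ⟧ x
⟦⊕⟧ [] q x = sym (ℤP.+-identityˡ _)
⟦⊕⟧ (a ∷ p) [] x = sym (ℤP.+-identityʳ _)
⟦⊕⟧ (a ∷ p) (b ∷ q) x = begin
  (a + b) + x * ⟦ p ⊕ q ⟧ x          ≡⟨ cong (λ z → (a + b) + x * z) (⟦⊕⟧ p q x) ⟩
  (a + b) + x * (⟦ p ⟧ x + ⟦ q ⟧ x)  ≡⟨ regroup a b (⟦ p ⟧ x) (⟦ q ⟧ x) x ⟩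
  (a + x * ⟦ p ⟧ x) + (b + x * ⟦ q ⟧ x) ∎
  where
  open ≡-Reasoning
  regroup : ∀ a b u v x → (a + b) + x * (u + v) ≡ (a + x * u) + (b + x * v)
  regroup = solve-∀

⟦scale⟧ : ∀ c p x → ⟦ map (c *_) p ⟧ x ≡ c * ⟦ p ⟧ x
⟦scale⟧ c [] x = sym (ℤP.*-zeroʳ c)
⟦scale⟧ c (a ∷ p) x = trans (cong (λ z → c * a + x * z) (⟦scale⟧ c p x)) (reassoc c a (⟦ p ⟧ x) x)
  where
  reassoc : ∀ c a u x → c * a + x * (c * u) ≡ c * (a + x * u)
  reassoc = solve-∀

_·[X-_] : Poly → ℕ → Poly
p ·[X- k ] = (+ 0 ∷ p) ⊕ map (- (+ k) *_) p

⟦·[X-]⟧ : ∀ p k x → ⟦ p ·[X- k ] ⟧ x ≡ ⟦ p ⟧ x * (x - + k)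
⟦·[X-]⟧ p k x = begin
  ⟦ (+ 0 ∷ p) ⊕ map (- (+ k) *_) p ⟧ x     ≡⟨ ⟦⊕⟧ (+ 0 ∷ p) (map (- (+ k) *_) p) x ⟩
  (+ 0 + x * ⟦ p ⟧ x) + ⟦ map (- (+ k) *_) p ⟧ x ≡⟨ cong (λ z → (+ 0 + x * ⟦ p ⟧ x) + z) (⟦scale⟧ (- (+ k)) p x) ⟩
  (+ 0 + x * ⟦ p ⟧ x) + (- (+ k)) * ⟦ p ⟧ x ≡⟨ factor (⟦ p ⟧ x) (+ k) x ⟩
  ⟦ p ⟧ x * (x - + k) ∎
  where
  open ≡-Reasoning
  factor : ∀ u k x → (+ 0 + x * u) + (- k) * u ≡ u * (x - k)
  factor = solve-∀

falling : ℕ → Poly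
falling zero = + 1 ∷ []
falling (suc k) = falling k ·[X- k ]

-- The conversion of the natural-number factor n ∸ k to the integer factor
-- n - k, valid whenever the other factor vanishes as soon as k > n.
cast-monus : ∀ a n k → (n < k → a ≡ 0) → + (a ℕ.* (n ∸ k)) ≡ + a * (+ n - + k)
cast-monus a n k vanish with k ℕ.≤? n
... | yes k≤n = trans (ℤP.pos-* a (n ∸ k)) (cong (+ a *_) (sym (trans (ℤP.m-n≡m⊖n n k) (ℤP.⊖-≥ k≤n))))
... | no k≰n rewrite vanish (ℕP.≰⇒> k≰n) = refl

module _ (n : ℕ) where

  unused : List (Fin n) → List (Fin n)
  unused [] = allFin n
  unused (x ∷ e) = filter (λ y → ¬? (y FinP.≟ x)) (unused e)

  ∈-unused⁺ : ∀ {y} e → y ∉ e → y ∈ unused e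
  ∈-unused⁺ [] _ = ∈P.∈-allFin _
  ∈-unused⁺ (x ∷ e) y∉x∷e = ∈P.∈-filter⁺ (λ y → ¬? (y FinP.≟ x))
    (∈-unused⁺ e (y∉x∷e ∘ there)) (y∉x∷e ∘ here)

  ∈-unused⁻ : ∀ {y} e → y ∈ unused e → y ∉ e
  ∈-unused⁻ (x ∷ e) y∈ (here y≡x) = proj₂ (∈P.∈-filter⁻ (λ y → ¬? (y FinP.≟ x)) {xs = unused e} y∈) y≡x
  ∈-unused⁻ (x ∷ e) y∈ (there y∈e) = ∈-unused⁻ e (proj₁ (∈P.∈-filter⁻ (λ y → ¬? (y FinP.≟ x)) {xs = unused e} y∈)) y∈e

  unused-unique : ∀ e → Unique (unused e)
  unused-unique [] = UniqueP.allFin⁺ n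
  unused-unique (x ∷ e) = UniqueP.filter⁺ (λ y → ¬? (y FinP.≟ x)) (unused-unique e)

  length-unused : ∀ e → Unique e → length (unused e) ℕ.+ length e ≡ n
  length-unused [] _ = trans (ℕP.+-identityʳ _) (ListP.length-tabulate (λ i → i))
  length-unused (x ∷ e) (x∉e ∷ u) = begin
    length (unused (x ∷ e)) ℕ.+ suc (length e)       ≡⟨ ℕP.+-suc _ (length e) ⟩
    suc (length (unused (x ∷ e))) ℕ.+ length e       ≡⟨ cong (ℕ._+ length e) (length-remove FinP._≟_
                                                          (unused-unique e) (∈-unused⁺ e (λ x∈e → All.lookup x∉e x∈e refl))) ⟩
    length (unused e) ℕ.+ length e                   ≡⟨ length-unused e u ⟩
    n ∎
    where open ≡-Reasoning

  extensions : List (Fin n) → List (List (Fin n))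
  extensions e = map (_∷ e) (unused e)

  arrangements : ℕ → List (List (Fin n))
  arrangements zero = [ [] ]
  arrangements (suc k) = concatMap extensions (arrangements k)

  ∈-arrangements⁻ : ∀ k {e} → e ∈ arrangements k → Unique e × length e ≡ k
  ∈-arrangements⁻ zero (here refl) = [] , refl
  ∈-arrangements⁻ (suc k) e∈ with ∈-concatMap⁻′ extensions (arrangements k) e∈
  ... | e' , e'∈ , x∷e'∈ with ∈P.∈-map⁻ (_∷ e') x∷e'∈
  ... | x , x∈ , refl with ∈-arrangements⁻ k e'∈
  ... | u , refl = All.tabulate (λ y∈e' x≡y → ∈-unused⁻ e' x∈ (subst (_∈ e') (sym x≡y) y∈e')) ∷ u , refl

  ∈-arrangements⁺ : ∀ e → Unique e → e ∈ arrangements (length e)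
  ∈-arrangements⁺ [] _ = here refl
  ∈-arrangements⁺ (x ∷ e) (x∉e ∷ u) = ∈-concatMap⁺′ extensions (∈-arrangements⁺ e u)
    (∈P.∈-map⁺ (_∷ e) (∈-unused⁺ e (λ x∈e → All.lookup x∉e x∈e refl)))

  arrangements-unique : ∀ k → Unique (arrangements k)
  arrangements-unique zero = [] ∷ []
  arrangements-unique (suc k) = concatMap-unique extensions tail (arrangements-unique k)
    (λ e _ → UniqueP.map⁺ ListP.∷-injectiveˡ (unused-unique e))
    (λ e y _ y∈ → tail-of (∈P.∈-map⁻ (_∷ e) y∈))
    where
    tail : List (Fin n) → List (Fin n)
    tail [] = []
    tail (_ ∷ e) = e
    tail-of : ∀ {e y} → ∃ (λ x → x ∈ unused e × y ≡ x ∷ e) → tail y ≡ e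
    tail-of (_ , _ , refl) = refl

  arrangements-vanish : ∀ k → n < k → length (arrangements k) ≡ 0
  arrangements-vanish k n<k with arrangements k in eq
  ... | [] = refl
  ... | e ∷ _ with ∈-arrangements⁻ k (subst (e ∈_) (sym eq) (here refl))
  ... | u , refl = contradiction (subst (length e ≤_) (length-unused e u) (ℕP.m≤n+m _ _)) (ℕP.<⇒≱ n<k)

  length-arrangements : ∀ k → + length (arrangements k) ≡ ⟦ falling k ⟧ (+ n)
  length-arrangements zero = cong (λ z → + 1 + z) (sym (ℤP.*-zeroʳ (+ n)))
  length-arrangements (suc k) = begin
    + length (arrangements (suc k))            ≡⟨ cong +_ (length-concatMap-const extensions (arrangements k) (n ∸ k) block) ⟩
    + (length (arrangements k) ℕ.* (n ∸ k))     ≡⟨ cast-monus _ n k (arrangements-vanish k) ⟩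
    + length (arrangements k) * (+ n - + k)    ≡⟨ cong (_* (+ n - + k)) (length-arrangements k) ⟩
    ⟦ falling k ⟧ (+ n) * (+ n - + k)          ≡⟨ sym (⟦·[X-]⟧ (falling k) k (+ n)) ⟩
    ⟦ falling (suc k) ⟧ (+ n) ∎
    where
    open ≡-Reasoning
    block : ∀ e → e ∈ arrangements k → length (map (_∷ e) (unused e)) ≡ n ∸ k
    block e e∈ with ∈-arrangements⁻ k e∈
    ... | u , refl = trans (ListP.length-map (_∷ e) (unused e))
                      (trans (sym (ℕP.m+n∸n≡m _ (length e))) (cong (_∸ length e) (length-unused e u)))

-- Restricted-growth patterns: a pattern labels some of m cells with class
-- numbers; it is canonical when each label is either a class already seen
-- or the next new class, so that classes are numbered by first occurrence.
Pattern : ℕ → Set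
Pattern m = Vec (Maybe ℕ) m

step : ℕ → Maybe ℕ → ℕ
step c nothing = c
step c (just l) = if does (l ℕ.≟ c) then suc c else c

Admissible : ℕ → Maybe ℕ → Set
Admissible c nothing = ⊤
Admissible c (just l) = l ≤ c

Canonical : ∀ {m} → ℕ → Pattern m → Set
Canonical c []ᵥ = ⊤
Canonical c (h ∷ᵥ p) = Admissible c h × Canonical (step c h) p

classes : ∀ {m} → ℕ → Pattern m → ℕ
classes c []ᵥ = c
classes c (h ∷ᵥ p) = classes (step c h) p

step-new : ∀ c → step c (just c) ≡ suc c
step-new c rewrite dec-true (c ℕ.≟ c) refl = refl

step-old : ∀ {c l} → l < c → step c (just l) ≡ c
step-old {c} {l} l<c rewrite dec-false (l ℕ.≟ c) (ℕP.<⇒≢ l<c) = refl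

step-≥ : ∀ c h → c ≤ step c h
step-≥ c nothing = ℕP.≤-refl
step-≥ c (just l) with does (l ℕ.≟ c)
... | true = ℕP.n≤1+n c
... | false = ℕP.≤-refl

classes-≥ : ∀ {m} c (p : Pattern m) → c ≤ classes c p
classes-≥ c []ᵥ = ℕP.≤-refl
classes-≥ c (h ∷ᵥ p) = ℕP.≤-trans (step-≥ c h) (classes-≥ (step c h) p)

label<classes : ∀ {m} c (p : Pattern m) → Canonical c p → ∀ a {l} → lookup p a ≡ just l → l < classes c p
label<classes c (just l ∷ᵥ p) (l≤c , _) zero refl = ℕP.<-≤-trans l<step (classes-≥ (step c (just l)) p)
  where
  l<step : l < step c (just l)
  l<step with ℕP.m≤n⇒m<n∨m≡n l≤c
  ... | inj₁ l<c = subst (l <_) (sym (step-old l<c)) l<c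
  ... | inj₂ refl = subst (l <_) (sym (step-new l)) (ℕP.n<1+n l)
label<classes c (h ∷ᵥ p) (_ , canon-p) (suc a) eq = label<classes (step c h) p canon-p a eq

admissibleLabels : ℕ → List (Maybe ℕ)
admissibleLabels c = nothing ∷ map just (upTo (suc c))

canonicalPatterns : ℕ → (m : ℕ) → List (Pattern m)
prefixed : ℕ → (m : ℕ) → Maybe ℕ → List (Pattern (suc m))
canonicalPatterns c zero = [ []ᵥ ]
canonicalPatterns c (suc m) = concatMap (prefixed c m) (admissibleLabels c)
prefixed c m h = map (h ∷ᵥ_) (canonicalPatterns (step c h) m)

∈-admissibleLabels⁺ : ∀ c h → Admissible c h → h ∈ admissibleLabels c
∈-admissibleLabels⁺ c nothing _ = here refl
∈-admissibleLabels⁺ c (just l) l≤c = there (∈P.∈-map⁺ just (∈P.∈-upTo⁺ (s≤s l≤c)))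

∈-admissibleLabels⁻ : ∀ c {h} → h ∈ admissibleLabels c → Admissible c h
∈-admissibleLabels⁻ c (here refl) = tt
∈-admissibleLabels⁻ c (there h∈) with ∈P.∈-map⁻ just h∈
... | l , l∈ , refl = ℕP.≤-pred (∈P.∈-upTo⁻ l∈)

admissibleLabels-unique : ∀ c → Unique (admissibleLabels c)
admissibleLabels-unique c =
  All.tabulate (λ {h} h∈ nothing≡h → just≢nothing h∈ nothing≡h)
  ∷ UniqueP.map⁺ just-injective (UniqueP.upTo⁺ (suc c))
  where
  just-injective : ∀ {x y : ℕ} → just x ≡ just y → x ≡ y
  just-injective refl = refl
  just≢nothing : ∀ {h} → h ∈ map just (upTo (suc c)) → nothing ≢ h
  just≢nothing h∈ refl with ∈P.∈-map⁻ just h∈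
  ... | _ , _ , ()

∈-canonicalPatterns⁺ : ∀ c {m} (p : Pattern m) → Canonical c p → p ∈ canonicalPatterns c m
∈-canonicalPatterns⁺ c []ᵥ _ = here refl
∈-canonicalPatterns⁺ c {suc m} (h ∷ᵥ p) (adm , canon-p) =
  ∈-concatMap⁺′ (prefixed c m) (∈-admissibleLabels⁺ c h adm)
    (∈P.∈-map⁺ (h ∷ᵥ_) (∈-canonicalPatterns⁺ (step c h) p canon-p))

∈-canonicalPatterns⁻ : ∀ c m {p : Pattern m} → p ∈ canonicalPatterns c m → Canonical c p
∈-canonicalPatterns⁻ c zero {[]ᵥ} _ = tt
∈-canonicalPatterns⁻ c (suc m) p∈ with ∈-concatMap⁻′ (prefixed c m) (admissibleLabels c) p∈
... | h , h∈ , hp∈ with ∈P.∈-map⁻ (h ∷ᵥ_) hp∈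
... | p , p∈ , refl = ∈-admissibleLabels⁻ c h∈ , ∈-canonicalPatterns⁻ (step c h) m p∈

canonicalPatterns-unique : ∀ c m → Unique (canonicalPatterns c m)
canonicalPatterns-unique c zero = [] ∷ []
canonicalPatterns-unique c (suc m) =
  concatMap-unique (prefixed c m) Vec.head (admissibleLabels-unique c)
    (λ h _ → UniqueP.map⁺ VecP.∷-injectiveʳ (canonicalPatterns-unique (step c h) m))
    (λ h p _ p∈ → head-of (∈P.∈-map⁻ (h ∷ᵥ_) p∈))
  where
  head-of : ∀ {h} {p : Pattern (suc m)} → ∃ (λ q → q ∈ canonicalPatterns (step c h) m × p ≡ h ∷ᵥ q) → Vec.head p ≡ h
  head-of (_ , _ , refl) = refl

sameSymbol : DecidableEquality A → Maybe A → Maybe A → Bool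
sameSymbol _≟_ (just a) (just b) = does (a ≟ b)
sameSymbol _≟_ _ _ = false

sameSymbol-true : (_≟_ : DecidableEquality A) {c d : Maybe A} →
  T (sameSymbol _≟_ c d) → ∃ λ s → c ≡ just s × d ≡ just s
sameSymbol-true _≟_ {just a} {just b} t with a ≟ b
... | yes refl = a , refl , refl

sameSymbol-refl : (_≟_ : DecidableEquality A) {c d : Maybe A} {s : A} →
  c ≡ just s → d ≡ just s → T (sameSymbol _≟_ c d)
sameSymbol-refl _≟_ {s = s} refl refl = subst T (sym (dec-true (s ≟ s) refl)) tt

-- Canonical forms of vectors of optional symbols drawn from a set with
-- decidable equality: such a vector is a canonical pattern together with
-- the list of its distinct symbols in order of first occurrence.
module CanonicalForm {S : Set} (_≟_ : DecidableEquality S) where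

  indexOf : S → List S → Maybe ℕ
  indexOf x [] = nothing
  indexOf x (y ∷ ys) with y ≟ x
  ... | yes _ = just 0
  ... | no _ = Maybe.map suc (indexOf x ys)

  indexOf-just : ∀ x ys {i} → indexOf x ys ≡ just i → ys !? i ≡ just x
  indexOf-just x (y ∷ ys) eq with y ≟ x
  indexOf-just x (y ∷ ys) refl | yes y≡x = cong just y≡x
  ... | no _ with indexOf x ys in eq'
  indexOf-just x (y ∷ ys) refl | no _ | just i = indexOf-just x ys eq'

  indexOf-nothing : ∀ x ys → indexOf x ys ≡ nothing → x ∉ ys
  indexOf-nothing x (y ∷ ys) eq x∈ with y ≟ x
  indexOf-nothing x (y ∷ ys) () x∈ | yes _
  ... | no y≢x with indexOf x ys in eq'
  indexOf-nothing x (y ∷ ys) eq (here x≡y) | no y≢x | nothing = y≢x (sym x≡y)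
  indexOf-nothing x (y ∷ ys) eq (there x∈) | no y≢x | nothing = indexOf-nothing x ys eq' x∈

  indexOf-!? : ∀ ys → Unique ys → ∀ i {x} → ys !? i ≡ just x → indexOf x ys ≡ just i
  indexOf-!? (y ∷ ys) _ zero refl with y ≟ y
  ... | yes _ = refl
  ... | no y≢y = contradiction refl y≢y
  indexOf-!? (y ∷ ys) (y∉ ∷ u) (suc i) {x} eq with y ≟ x
  ... | yes y≡x = contradiction y≡x (All.lookup y∉ (!?-∈ ys i eq))
  ... | no _ rewrite indexOf-!? ys u i eq = refl

  indexOf-∉ : ∀ x ys → x ∉ ys → indexOf x ys ≡ nothing
  indexOf-∉ x ys x∉ with indexOf x ys in eq
  ... | nothing = refl
  ... | just i = contradiction (!?-∈ ys i (indexOf-just x ys eq)) x∉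

  relabel : ∀ {m} → List S → Pattern m → Vec (Maybe S) m
  relabel e = Vec.map (λ h → h Maybe.>>= (e !?_))

  canon : ∀ {m} → List S → Vec (Maybe S) m → Pattern m × List S
  canon seen []ᵥ = []ᵥ , seen
  canon seen (nothing ∷ᵥ v) = Product.map₁ (nothing ∷ᵥ_) (canon seen v)
  canon seen (just x ∷ᵥ v) with indexOf x seen
  ... | just i = Product.map₁ (just i ∷ᵥ_) (canon seen v)
  ... | nothing = Product.map₁ (just (length seen) ∷ᵥ_) (canon (seen ++ [ x ]) v)

  canon-extends : ∀ {m} seen (v : Vec (Maybe S) m) → ∃ λ t → proj₂ (canon seen v) ≡ seen ++ t
  canon-extends seen []ᵥ = [] , sym (ListP.++-identityʳ seen)
  canon-extends seen (nothing ∷ᵥ v) = canon-extends seen v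
  canon-extends seen (just x ∷ᵥ v) with indexOf x seen
  ... | just _ = canon-extends seen v
  ... | nothing with canon-extends (seen ++ [ x ]) v
  ... | t , eq = x ∷ t , trans eq (ListP.++-assoc seen [ x ] t)

  canon-unique : ∀ {m} seen (v : Vec (Maybe S) m) → Unique seen → Unique (proj₂ (canon seen v))
  canon-unique seen []ᵥ u = u
  canon-unique seen (nothing ∷ᵥ v) u = canon-unique seen v u
  canon-unique seen (just x ∷ᵥ v) u with indexOf x seen in eq
  ... | just _ = canon-unique seen v u
  ... | nothing = canon-unique (seen ++ [ x ]) v (UniqueP.++⁺ u ([] ∷ []) fresh)
    where
    fresh : ∀ {y} → ¬ (y ∈ seen × y ∈ [ x ])
    fresh (y∈ , here refl) = indexOf-nothing x seen eq y∈

  canon-canonical : ∀ {m} seen (v : Vec (Maybe S) m) → Canonical (length seen) (proj₁ (canon seen v))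
  canon-canonical seen []ᵥ = tt
  canon-canonical seen (nothing ∷ᵥ v) = tt , canon-canonical seen v
  canon-canonical seen (just x ∷ᵥ v) with indexOf x seen in eq
  ... | just i = ℕP.<⇒≤ i<c , subst (λ c → Canonical c (proj₁ (canon seen v))) (sym (step-old i<c)) (canon-canonical seen v)
    where
    i<c : i < length seen
    i<c = !?-bound seen i (indexOf-just x seen eq)
  ... | nothing = ℕP.≤-refl , subst (λ c → Canonical c (proj₁ (canon (seen ++ [ x ]) v)))
    (trans (length-snoc seen x) (sym (step-new (length seen)))) (canon-canonical (seen ++ [ x ]) v)

  canon-classes : ∀ {m} seen (v : Vec (Maybe S) m) →
    classes (length seen) (proj₁ (canon seen v)) ≡ length (proj₂ (canon seen v))
  canon-classes seen []ᵥ = refl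
  canon-classes seen (nothing ∷ᵥ v) = canon-classes seen v
  canon-classes seen (just x ∷ᵥ v) with indexOf x seen in eq
  ... | just i rewrite step-old (!?-bound seen i (indexOf-just x seen eq)) = canon-classes seen v
  ... | nothing rewrite step-new (length seen) = subst
    (λ c → classes c (proj₁ (canon (seen ++ [ x ]) v)) ≡ length (proj₂ (canon (seen ++ [ x ]) v)))
    (length-snoc seen x) (canon-classes (seen ++ [ x ]) v)

  canon-relabel : ∀ {m} seen (v : Vec (Maybe S) m) → relabel (proj₂ (canon seen v)) (proj₁ (canon seen v)) ≡ v
  canon-relabel seen []ᵥ = refl
  canon-relabel seen (nothing ∷ᵥ v) = cong (nothing ∷ᵥ_) (canon-relabel seen v)
  canon-relabel seen (just x ∷ᵥ v) with indexOf x seen in eq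
  ... | just i with canon-extends seen v
  ... | t , ext = cong₂ _∷ᵥ_ head (canon-relabel seen v)
    where
    head : proj₂ (canon seen v) !? i ≡ just x
    head rewrite ext = trans (!?-++ˡ seen t (!?-bound seen i (indexOf-just x seen eq))) (indexOf-just x seen eq)
  canon-relabel seen (just x ∷ᵥ v) | nothing with canon-extends (seen ++ [ x ]) v
  ... | t , ext = cong₂ _∷ᵥ_ head (canon-relabel (seen ++ [ x ]) v)
    where
    head : proj₂ (canon (seen ++ [ x ]) v) !? length seen ≡ just x
    head rewrite ext | ListP.++-assoc seen [ x ] t = !?-length seen t x

  canon-relabel⁻¹ : ∀ {m} seen t (p : Pattern m) → Unique (seen ++ t) →
    Canonical (length seen) p → classes (length seen) p ≡ length (seen ++ t) →
    canon seen (relabel (seen ++ t) p) ≡ (p , seen ++ t)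
  canon-relabel⁻¹ seen [] []ᵥ _ _ _ = cong ([]ᵥ ,_) (sym (ListP.++-identityʳ seen))
  canon-relabel⁻¹ seen (x ∷ t) []ᵥ _ _ eq = contradiction eq (ℕP.<⇒≢ longer)
    where
    longer : length seen < length (seen ++ x ∷ t)
    longer = subst (length seen <_) (sym (ListP.length-++ seen)) (ℕP.m<m+n (length seen) (s≤s z≤n))
  canon-relabel⁻¹ seen t (nothing ∷ᵥ p) u (_ , cp) eq rewrite canon-relabel⁻¹ seen t p u cp eq = refl
  canon-relabel⁻¹ seen t (just l ∷ᵥ p) u (l≤c , cp) eq with ℕP.m≤n⇒m<n∨m≡n l≤c
  ... | inj₁ l<c with !?-defined seen l<c
  ... | y , ey rewrite !?-++ˡ seen t l<c | ey | indexOf-!? seen (unique-++ˡ seen t u) l ey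
                     | canon-relabel⁻¹ seen t p u (subst (λ c → Canonical c p) (step-old l<c) cp)
                         (trans (cong (λ c → classes c p) (sym (step-old l<c))) eq) = refl
  canon-relabel⁻¹ seen [] (just l ∷ᵥ p) u (l≤c , cp) eq | inj₂ refl =
    contradiction (sym eq) (ℕP.<⇒≢ (subst₂ _<_ (sym (cong length (ListP.++-identityʳ seen)))
      (cong (λ c → classes c p) (sym (step-new (length seen)))) (classes-≥ (suc (length seen)) p)))
  canon-relabel⁻¹ seen (x ∷ t) (just l ∷ᵥ p) u (l≤c , cp) eq | inj₂ refl
    rewrite !?-length seen t x | indexOf-∉ x seen (unique-middle seen t x u) =
    cong (Product.map₁ (just (length seen) ∷ᵥ_)) (subst (λ e → canon seen′ (relabel e p) ≡ (p , e)) assoc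
      (canon-relabel⁻¹ seen′ t p (subst Unique (sym assoc) u)
        (subst (λ c → Canonical c p) new cp) (trans (cong (λ c → classes c p) (sym new)) (trans eq (cong length (sym assoc))))))
    where
    seen′ : List S
    seen′ = seen ++ [ x ]
    assoc : seen′ ++ t ≡ seen ++ x ∷ t
    assoc = ListP.++-assoc seen [ x ] t
    new : step (length seen) (just (length seen)) ≡ length seen′
    new = trans (step-new (length seen)) (sym (length-snoc seen x))

  SameShape : ∀ {m} → Vec (Maybe S) m → Pattern m → Set
  SameShape v p = ∀ a b → sameSymbol _≟_ (lookup v a) (lookup v b) ≡ sameSymbol ℕ._≟_ (lookup p a) (lookup p b)

  relabel-shape : ∀ {m} e (p : Pattern m) → Unique e →
    (∀ a {l} → lookup p a ≡ just l → l < length e) → SameShape (relabel e p) p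
  relabel-shape e p u bounded a b
    rewrite VecP.lookup-map a (λ h → h Maybe.>>= (e !?_)) p | VecP.lookup-map b (λ h → h Maybe.>>= (e !?_)) p
    = cell (lookup p a) (lookup p b) (bounded a) (bounded b)
    where
    cell : (c d : Maybe ℕ) → (∀ {l} → c ≡ just l → l < length e) → (∀ {l} → d ≡ just l → l < length e) →
      sameSymbol _≟_ (c Maybe.>>= (e !?_)) (d Maybe.>>= (e !?_)) ≡ sameSymbol ℕ._≟_ c d
    cell nothing d _ _ = refl
    cell (just l) nothing bc _ with !?-defined e (bc refl)
    ... | x , ex rewrite ex = refl
    cell (just l) (just l') bc bd with !?-defined e (bc refl) | !?-defined e (bd refl)
    ... | x , ex | x' , ex' rewrite ex | ex' with x ≟ x'
    ... | yes refl = sym (dec-true (l ℕ.≟ l') (!?-injective e u l l' ex ex'))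
    ... | no x≢x' = sym (dec-false (l ℕ.≟ l') λ { refl → x≢x' (just-injective (trans (sym ex) ex')) })
      where
      just-injective : ∀ {y z : S} → just y ≡ just z → y ≡ z
      just-injective refl = refl

  canon-shape : ∀ {m} (v : Vec (Maybe S) m) → SameShape v (proj₁ (canon [] v))
  canon-shape v = subst (λ w → SameShape w p) (canon-relabel [] v)
    (relabel-shape e p (canon-unique [] v []) bounded)
    where
    p = proj₁ (canon [] v)
    e = proj₂ (canon [] v)
    bounded : ∀ a {l} → lookup p a ≡ just l → l < length e
    bounded a eq = subst (_ <_) (canon-classes [] v) (label<classes 0 p (canon-canonical [] v) a eq)

module FinCanonicalForm {n : ℕ} = CanonicalForm (FinP._≟_ {n})
open FinCanonicalForm

-- Counting vectors over [n] with a property that depends only on their shape: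
-- if a Boolean test on canonical patterns decides the property for all vectors
-- of the same shape, then the vectors with the property are exactly the
-- relabellings of accepted patterns p by k(p) distinct symbols, so their number
-- is the sum of the falling factorials (n)_{k(p)}, with k(p) the class count.
module ShapeCount {m : ℕ} (accepts : Pattern m → Bool)
  (Holds : ∀ {n} → Vec (Maybe (Fin n)) m → Set)
  (decides : ∀ {n} (v : Vec (Maybe (Fin n)) m) (p : Pattern m) → SameShape v p →
    (Holds v → T (accepts p)) × (T (accepts p) → Holds v)) where

  accepted : List (Pattern m)
  accepted = filter (T? ∘ accepts) (canonicalPatterns 0 m)

  realisations : (n : ℕ) → Pattern m → List (Vec (Maybe (Fin n)) m)
  realisations n p = map (λ e → relabel e p) (arrangements n (classes 0 p))

  solutions : (n : ℕ) → List (Vec (Maybe (Fin n)) m)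
  solutions n = concatMap (realisations n) accepted

  countingPolynomial : Poly
  countingPolynomial = foldr _⊕_ [] (map (falling ∘ classes 0) accepted)

  accepted-canonical : ∀ {p} → p ∈ accepted → Canonical 0 p
  accepted-canonical p∈ = ∈-canonicalPatterns⁻ 0 m (proj₁ (∈P.∈-filter⁻ (T? ∘ accepts) {xs = canonicalPatterns 0 m} p∈))

  canon-realisation : ∀ {n p e} → p ∈ accepted → e ∈ arrangements n (classes 0 p) →
    canon [] (relabel e p) ≡ (p , e)
  canon-realisation {n} {p} p∈ e∈ with ∈-arrangements⁻ n (classes 0 p) e∈
  ... | u , len = canon-relabel⁻¹ [] _ p u (accepted-canonical p∈) (sym len)

  solutions-unique : ∀ n → Unique (solutions n)
  solutions-unique n = concatMap-unique (realisations n) (proj₁ ∘ canon []) accepted-unique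
    (λ p p∈ → map-unique-retract _ (proj₂ ∘ canon []) (λ e e∈ → cong proj₂ (canon-realisation p∈ e∈))
      (arrangements-unique n (classes 0 p)))
    (λ p v p∈ v∈ → pattern-of p∈ (∈P.∈-map⁻ _ v∈))
    where
    accepted-unique : Unique accepted
    accepted-unique = UniqueP.filter⁺ (T? ∘ accepts) (canonicalPatterns-unique 0 m)
    pattern-of : ∀ {p v} → p ∈ accepted → ∃ (λ e → e ∈ arrangements n (classes 0 p) × v ≡ relabel e p) →
      proj₁ (canon [] v) ≡ p
    pattern-of p∈ (e , e∈ , refl) = cong proj₁ (canon-realisation p∈ e∈)

  ∈-solutions⁺ : ∀ n (v : Vec (Maybe (Fin n)) m) → Holds v → v ∈ solutions n
  ∈-solutions⁺ n v holds = subst (_∈ solutions n) (canon-relabel [] v)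
    (∈-concatMap⁺′ (realisations n) p∈ (∈P.∈-map⁺ (λ e → relabel e p) e∈))
    where
    p = proj₁ (canon [] v)
    e = proj₂ (canon [] v)
    p∈ : p ∈ accepted
    p∈ = ∈P.∈-filter⁺ (T? ∘ accepts) (∈-canonicalPatterns⁺ 0 p (canon-canonical [] v))
      (proj₁ (decides v p (canon-shape v)) holds)
    e∈ : e ∈ arrangements n (classes 0 p)
    e∈ = subst (λ k → e ∈ arrangements n k) (sym (canon-classes [] v)) (∈-arrangements⁺ n e (canon-unique [] v []))

  ∈-solutions⁻ : ∀ n {v : Vec (Maybe (Fin n)) m} → v ∈ solutions n → Holds v
  ∈-solutions⁻ n v∈ with ∈-concatMap⁻′ (realisations n) accepted v∈
  ... | p , p∈ , v∈′ with ∈P.∈-map⁻ (λ e → relabel e p) v∈′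
  ... | e , e∈ , refl = proj₂ (decides (relabel e p) p shape) accepts-p
    where
    accepts-p : T (accepts p)
    accepts-p = proj₂ (∈P.∈-filter⁻ (T? ∘ accepts) {xs = canonicalPatterns 0 m} p∈)
    shape : SameShape (relabel e p) p
    shape with ∈-arrangements⁻ n (classes 0 p) e∈
    ... | u , len = relabel-shape e p u
      (λ a eq → subst (_ <_) (sym len) (label<classes 0 p (accepted-canonical p∈) a eq))

  length-solutions : ∀ n → + length (solutions n) ≡ ⟦ countingPolynomial ⟧ (+ n)
  length-solutions n = sum-over accepted
    where
    sum-over : ∀ ps → + length (concatMap (realisations n) ps) ≡ ⟦ foldr _⊕_ [] (map (falling ∘ classes 0) ps) ⟧ (+ n)
    sum-over [] = refl
    sum-over (p ∷ ps) = begin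
      + length (realisations n p ++ concatMap (realisations n) ps)
        ≡⟨ cong +_ (ListP.length-++ (realisations n p)) ⟩
      + length (realisations n p) + + length (concatMap (realisations n) ps)
        ≡⟨ cong₂ _+_ (trans (cong +_ (ListP.length-map _ (arrangements n (classes 0 p))))
                            (length-arrangements n (classes 0 p))) (sum-over ps) ⟩
      ⟦ falling (classes 0 p) ⟧ (+ n) + ⟦ foldr _⊕_ [] (map (falling ∘ classes 0) ps) ⟧ (+ n)
        ≡⟨ sym (⟦⊕⟧ (falling (classes 0 p)) _ (+ n)) ⟩
      ⟦ foldr _⊕_ [] (map (falling ∘ classes 0) (p ∷ ps)) ⟧ (+ n) ∎
      where open ≡-Reasoning

  counting : ∀ n → HasCard (Holds {n}) (⟦ countingPolynomial ⟧ (+ n))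
  counting n = solutions n , solutions-unique n , (λ v → ∈-solutions⁺ n v , ∈-solutions⁻ n) , length-solutions n

allFinᵇ : ∀ {r} → (Fin r → Bool) → Bool
allFinᵇ {zero} f = true
allFinᵇ {suc r} f = f zero ∧ allFinᵇ (f ∘ suc)

allFinᵇ-sound : ∀ {r} (f : Fin r → Bool) → T (allFinᵇ f) → ∀ i → T (f i)
allFinᵇ-sound f t zero with f zero
... | true = tt
allFinᵇ-sound f t (suc i) with f zero
... | true = allFinᵇ-sound (f ∘ suc) t i

allFinᵇ-complete : ∀ {r} (f : Fin r → Bool) → (∀ i → T (f i)) → T (allFinᵇ f)
allFinᵇ-complete {zero} f h = tt
allFinᵇ-complete {suc r} f h with f zero | h zero
... | true | _ = allFinᵇ-complete (f ∘ suc) (h ∘ suc)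

-- A relation "cells (i , j) and (i' , j') hold the same symbol".
SameRel : ℕ → Set
SameRel r = Fin r → Fin r → Fin r → Fin r → Bool

_==_ : ∀ {r} → Fin r → Fin r → Bool
i == i' = does (i FinP.≟ i')

-- The conditions of SOR for one pair of cells, expressed through the
-- relation same: two distinct cells with a common symbol lie in distinct
-- rows and distinct columns, and their mirror cells (j , i) and (j' , i')
-- do not hold a common symbol.
pairOK : ∀ {r} → SameRel r → Fin r → Fin r → Fin r → Fin r → Bool
pairOK same i j i' j' = (i == i' ∧ j == j') ∨ not (same i j i' j' ∧ (i == i' ∨ j == j' ∨ same j i j' i'))

sorTest : ∀ {r} → SameRel r → Bool
sorTest same = allFinᵇ λ i → allFinᵇ λ j → allFinᵇ λ i' → allFinᵇ λ j' → pairOK same i j i' j'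

sorTest-sound : ∀ {r} (same : SameRel r) → T (sorTest same) → ∀ i j i' j' → T (pairOK same i j i' j')
sorTest-sound same t i j i' j' =
  allFinᵇ-sound _ (allFinᵇ-sound _ (allFinᵇ-sound _ (allFinᵇ-sound _ t i) j) i') j'

sorTest-complete : ∀ {r} (same : SameRel r) → (∀ i j i' j' → T (pairOK same i j i' j')) → T (sorTest same)
sorTest-complete same h = allFinᵇ-complete _ λ i → allFinᵇ-complete _ λ j →
  allFinᵇ-complete _ λ i' → allFinᵇ-complete _ λ j' → h i j i' j'

pairOK-cong : ∀ {r} (same same' : SameRel r) → (∀ i j i' j' → same i j i' j' ≡ same' i j i' j') →
  ∀ i j i' j' → pairOK same i j i' j' ≡ pairOK same' i j i' j'
pairOK-cong same same' eq i j i' j' rewrite eq i j i' j' | eq j i j' i' = refl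

pairOK-elim : ∀ {r} (same : SameRel r) {i j i' j'} → T (pairOK same i j i' j') → (i , j) ≢ (i' , j') →
  T (same i j i' j') → i ≢ i' × j ≢ j' × ¬ T (same j i j' i')
pairOK-elim same {i} {j} {i'} {j'} ok distinct s
  with i FinP.≟ i' | j FinP.≟ j' | same i j i' j' | same j i j' i'
... | yes refl | yes refl | _ | _ = contradiction refl distinct
... | _ | _ | false | _ = ⊥-elim s
... | yes _ | no _ | true | _ = ⊥-elim ok
... | no _ | yes _ | true | _ = ⊥-elim ok
... | no _ | no _ | true | true = ⊥-elim ok
... | no i≢i' | no j≢j' | true | false = i≢i' , j≢j' , λ ()

pairOK-intro : ∀ {r} (same : SameRel r) {i j i' j'} → (i , j) ≡ (i' , j') ⊎
  (T (same i j i' j') → i ≢ i' × j ≢ j' × ¬ T (same j i j' i')) → T (pairOK same i j i' j')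
pairOK-intro same {i} {j} (inj₁ refl) with i FinP.≟ i | j FinP.≟ j
... | yes _ | yes _ = tt
... | no i≢i | _ = contradiction refl i≢i
... | yes _ | no j≢j = contradiction refl j≢j
pairOK-intro same {i} {j} {i'} {j'} (inj₂ h)
  with i FinP.≟ i' | j FinP.≟ j' | same i j i' j' | same j i j' i'
... | _ | _ | false | _ = Equivalence.from BoolP.T-∨ (inj₂ tt)
... | yes refl | yes refl | true | _ = tt
... | yes refl | no _ | true | _ = contradiction refl (proj₁ (h tt))
... | no _ | yes refl | true | _ = contradiction refl (proj₁ (proj₂ (h tt)))
... | no _ | no _ | true | true = contradiction tt (proj₂ (proj₂ (h tt)))
... | no _ | no _ | true | false = tt

sameCells : ∀ {r n} → Array r n → SameRel r
sameCells A i j i' j' = sameSymbol FinP._≟_ (entry A i j) (entry A i' j')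

lookup-transpose : ∀ {k m} (row : Vec A m) (rows : Vec (Vec A m) k) i →
  lookup (Vec.transpose (row ∷ᵥ rows)) i ≡ lookup row i ∷ᵥ lookup (Vec.transpose rows) i
lookup-transpose row rows i = begin
  lookup (Vec.replicate _ _∷ᵥ_ Vec.⊛ row Vec.⊛ Vec.transpose rows) i
    ≡⟨ VecP.lookup-⊛ i (Vec.replicate _ _∷ᵥ_ Vec.⊛ row) (Vec.transpose rows) ⟩
  lookup (Vec.replicate _ _∷ᵥ_ Vec.⊛ row) i (lookup (Vec.transpose rows) i)
    ≡⟨ cong (λ f → f (lookup (Vec.transpose rows) i)) (VecP.lookup-⊛ i (Vec.replicate _ _∷ᵥ_) row) ⟩
  lookup (Vec.replicate _ _∷ᵥ_) i (lookup row i) (lookup (Vec.transpose rows) i)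
    ≡⟨ cong (λ f → f (lookup row i) (lookup (Vec.transpose rows) i)) (VecP.lookup-replicate i _∷ᵥ_) ⟩
  lookup row i ∷ᵥ lookup (Vec.transpose rows) i ∎
  where open ≡-Reasoning

entry-transpose : ∀ {k m} (X : Vec (Vec A m) k) i j → lookup (lookup (Vec.transpose X) i) j ≡ lookup (lookup X j) i
entry-transpose (row ∷ᵥ rows) i zero = cong (λ v → lookup v zero) (lookup-transpose row rows i)
entry-transpose (row ∷ᵥ rows) i (suc j) =
  trans (cong (λ v → lookup v (suc j)) (lookup-transpose row rows i)) (entry-transpose rows i j)

sor⇒pairOK : ∀ {r n} (A : Array r n) → IsSOR r n A → ∀ i j i' j' → T (pairOK (sameCells A) i j i' j')
sor⇒pairOK A ((rows , cols) , orth) i j i' j' with ProductP.≡-dec FinP._≟_ FinP._≟_ (i , j) (i' , j')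
... | yes same-cell = pairOK-intro (sameCells A) (inj₁ same-cell)
... | no distinct = pairOK-intro (sameCells A) (inj₂ λ s →
  let σ , e , e' = sameSymbol-true FinP._≟_ s in
  (λ { refl → distinct (cong (i ,_) (rows i j j' σ e e')) }) ,
  (λ { refl → distinct (cong (_, j) (cols i i' j σ e e')) }) ,
  (λ sᵀ → let τ , f , f' = sameSymbol-true FinP._≟_ sᵀ in
    orth i j i' j' σ τ distinct e e' (trans (entry-transpose A i j) f) (trans (entry-transpose A i' j') f')))

pairOK⇒sor : ∀ {r n} (A : Array r n) → (∀ i j i' j' → T (pairOK (sameCells A) i j i' j')) → IsSOR r n A
pairOK⇒sor A ok = (rows , cols) , orth
  where
  rows : ∀ i j j' s → entry A i j ≡ just s → entry A i j' ≡ just s → j ≡ j'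
  rows i j j' s e e' with j FinP.≟ j'
  ... | yes j≡j' = j≡j'
  ... | no j≢j' = contradiction refl
    (proj₁ (pairOK-elim (sameCells A) (ok i j i j') (j≢j' ∘ cong proj₂) (sameSymbol-refl FinP._≟_ e e')))
  cols : ∀ i i' j s → entry A i j ≡ just s → entry A i' j ≡ just s → i ≡ i'
  cols i i' j s e e' with i FinP.≟ i'
  ... | yes i≡i' = i≡i'
  ... | no i≢i' = contradiction refl
    (proj₁ (proj₂ (pairOK-elim (sameCells A) (ok i j i' j) (i≢i' ∘ cong proj₁) (sameSymbol-refl FinP._≟_ e e'))))
  orth : Orthogonal A (Vec.transpose A)
  orth i j i' j' s t distinct e e' f f' =
    proj₂ (proj₂ (pairOK-elim (sameCells A) (ok i j i' j') distinct (sameSymbol-refl FinP._≟_ e e')))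
      (sameSymbol-refl FinP._≟_ (trans (sym (entry-transpose A i j)) f) (trans (sym (entry-transpose A i' j')) f'))

-- Arrays as flat vectors of their cells, row by row.
unflatten : ∀ r → Vec A (r ℕ.* r) → Vec (Vec A r) r
unflatten r v = proj₁ (Vec.group r r v)

concat-unflatten : ∀ r (v : Vec A (r ℕ.* r)) → Vec.concat (unflatten r v) ≡ v
concat-unflatten r v = sym (proj₂ (Vec.group r r v))

concat-injective : ∀ {k m} (X Y : Vec (Vec A m) k) → Vec.concat X ≡ Vec.concat Y → X ≡ Y
concat-injective []ᵥ []ᵥ _ = refl
concat-injective (x ∷ᵥ X) (y ∷ᵥ Y) eq =
  cong₂ _∷ᵥ_ (VecP.++-injectiveˡ x y eq) (concat-injective X Y (VecP.++-injectiveʳ x y eq))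

unflatten-concat : ∀ r (X : Vec (Vec A r) r) → unflatten r (Vec.concat X) ≡ X
unflatten-concat r X = concat-injective _ X (concat-unflatten r (Vec.concat X))

entry-unflatten : ∀ r (v : Vec A (r ℕ.* r)) i j → lookup (lookup (unflatten r v) i) j ≡ lookup v (Fin.combine i j)
entry-unflatten r v i j = trans (sym (VecP.lookup-concat (unflatten r v) i j))
  (cong (λ w → lookup w (Fin.combine i j)) (concat-unflatten r v))

HasCard-bijection : {P : A → Set} {k : ℤ} (f : B → A) (g : A → B) →
  (∀ x → f (g x) ≡ x) → (∀ y → g (f y) ≡ y) → HasCard (P ∘ f) k → HasCard P k
HasCard-bijection {P = P} f g fg gf (L , u , mem , len) =
  map f L , map-unique-retract f g (λ y _ → gf y) u , mem′ , trans (cong +_ (ListP.length-map f L)) len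
  where
  mem′ : ∀ x → (P x → x ∈ map f L) × (x ∈ map f L → P x)
  mem′ x = (λ px → subst (_∈ map f L) (fg x) (∈P.∈-map⁺ f (proj₁ (mem (g x)) (subst P (sym (fg x)) px))))
         , λ x∈ → from (∈P.∈-map⁻ f x∈)
    where
    from : ∃ (λ y → y ∈ L × x ≡ f y) → P x
    from (y , y∈ , refl) = proj₂ (mem y) y∈

samePattern : ∀ {r} → Pattern (r ℕ.* r) → SameRel r
samePattern p i j i' j' = sameSymbol ℕ._≟_ (lookup p (Fin.combine i j)) (lookup p (Fin.combine i' j'))

sor-decided : ∀ {r n} (v : Vec (Maybe (Fin n)) (r ℕ.* r)) (p : Pattern (r ℕ.* r)) → SameShape v p →
  (IsSOR r n (unflatten r v) → T (sorTest (samePattern {r} p))) × (T (sorTest (samePattern {r} p)) → IsSOR r n (unflatten r v))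
sor-decided {r} v p shape =
  (λ sor → sorTest-complete (samePattern p) λ i j i' j' →
     subst T (pairOK-cong _ _ same i j i' j') (sor⇒pairOK X sor i j i' j')) ,
  (λ t → pairOK⇒sor X λ i j i' j' →
     subst T (sym (pairOK-cong _ _ same i j i' j')) (sorTest-sound (samePattern p) t i j i' j'))
  where
  X : Array r _
  X = unflatten r v
  same : ∀ i j i' j' → sameCells X i j i' j' ≡ samePattern p i j i' j'
  same i j i' j' = trans (cong₂ (sameSymbol FinP._≟_) (entry-unflatten r v i j) (entry-unflatten r v i' j'))
    (shape (Fin.combine i j) (Fin.combine i' j'))

module SORCount (r : ℕ) = ShapeCount (sorTest ∘ samePattern {r}) (λ {n} v → IsSOR r n (unflatten r v)) sor-decided

sorPolynomial : ℕ → Poly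
sorPolynomial r = SORCount.countingPolynomial r

sor-count : ∀ r n → HasCard (IsSOR r n) (⟦ sorPolynomial r ⟧ (+ n))
sor-count r n = HasCard-bijection (unflatten r) Vec.concat (unflatten-concat r) (concat-unflatten r) (SORCount.counting r n)

sor-closed-form : ∀ r {c : Poly} {f : ℤ → ℤ} → sorPolynomial r ≡ c → (∀ x → ⟦ c ⟧ x ≡ f x) →
  ∀ n → HasCard (IsSOR r n) (f (+ n))
sor-closed-form r refl closed n = subst (HasCard (IsSOR r n)) (closed (+ n)) (sor-count r n)

horner : ∀ {k} → Poly → Polynomial k → Polynomial k
horner [] x = con (+ 0)
horner (a ∷ p) x = con a :+ x :* horner p x

census₁ : sorPolynomial 1 ≡ + 1 ∷ + 1 ∷ []
census₁ = refl

census₂ : sorPolynomial 2 ≡ + 1 ∷ + 0 ∷ + 5 ∷ - + 2 ∷ + 1 ∷ []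
census₂ = refl

census₃ : sorPolynomial 3 ≡ + 1 ∷ + 1347 ∷ - + 4240 ∷ + 5640 ∷ - + 4201 ∷ + 1973 ∷ - + 604 ∷ + 122 ∷ - + 15 ∷ + 1 ∷ []
census₃ = refl

closed₁ : ∀ x → ⟦ + 1 ∷ + 1 ∷ [] ⟧ x ≡ x + + 1
closed₁ = solve 1 (λ x → horner (+ 1 ∷ + 1 ∷ []) x := x :+ con (+ 1)) refl

closed₂ : ∀ x → ⟦ + 1 ∷ + 0 ∷ + 5 ∷ - + 2 ∷ + 1 ∷ [] ⟧ x ≡ x ^ 4 - + 2 * x ^ 3 + + 5 * x ^ 2 + + 1
closed₂ = solve 1 (λ x → horner (+ 1 ∷ + 0 ∷ + 5 ∷ - + 2 ∷ + 1 ∷ []) x :=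
  x :^ 4 :- con (+ 2) :* x :^ 3 :+ con (+ 5) :* x :^ 2 :+ con (+ 1)) refl

closed₃ : ∀ x → ⟦ + 1 ∷ + 1347 ∷ - + 4240 ∷ + 5640 ∷ - + 4201 ∷ + 1973 ∷ - + 604 ∷ + 122 ∷ - + 15 ∷ + 1 ∷ [] ⟧ x ≡
  x ^ 9 - + 15 * x ^ 8 + + 122 * x ^ 7 - + 604 * x ^ 6 + + 1973 * x ^ 5
    - + 4201 * x ^ 4 + + 5640 * x ^ 3 - + 4240 * x ^ 2 + + 1347 * x + + 1
closed₃ = solve 1 (λ x →
  horner (+ 1 ∷ + 1347 ∷ - + 4240 ∷ + 5640 ∷ - + 4201 ∷ + 1973 ∷ - + 604 ∷ + 122 ∷ - + 15 ∷ + 1 ∷ []) x :=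
  x :^ 9 :- con (+ 15) :* x :^ 8 :+ con (+ 122) :* x :^ 7 :- con (+ 604) :* x :^ 6 :+ con (+ 1973) :* x :^ 5
    :- con (+ 4201) :* x :^ 4 :+ con (+ 5640) :* x :^ 3 :- con (+ 4240) :* x :^ 2 :+ con (+ 1347) :* x :+ con (+ 1)) refl

theorem7 : (n : ℕ) →
    HasCard (IsSOR 1 n) (+ n + + 1)
    × HasCard (IsSOR 2 n) ((+ n) ^ 4 - + 2 * (+ n) ^ 3 + + 5 * (+ n) ^ 2 + + 1)
    × HasCard (IsSOR 3 n)
        ((+ n) ^ 9 - + 15 * (+ n) ^ 8 + + 122 * (+ n) ^ 7 - + 604 * (+ n) ^ 6 + + 1973 * (+ n) ^ 5
          - + 4201 * (+ n) ^ 4 + + 5640 * (+ n) ^ 3 - + 4240 * (+ n) ^ 2 + + 1347 * + n + + 1)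
theorem7 n =
  sor-closed-form 1 census₁ closed₁ n ,
  sor-closed-form 2 census₂ closed₂ n ,
  sor-closed-form 3 census₃ closed₃ n
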